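{- Let $B$ be a bounded complete predomain base. Then the canonical embedding $B\hookrightarrow\hat B$, $b\mapsto(b)_n$, preserves and reflects $\sqsubseteq$ and preserves $\ll$.
   Context: Work constructively; $\tilde\exists x.A$ abbreviates $\neg\forall x.\neg A$. In a poset, a chain is a sequence $(x_n)$ with $x_n\sqsubseteq x_{n+1}$; $b\ll c$ means: for every chain $(x_n)$ whose supremum exists and satisfies $c\sqsubseteq\bigsqcup_n x_n$, there weakly exists $n$ with $b\sqsubseteq x_n$. An approximating sequence of $b$ is a chain $(b_n)$ with $b_n\ll b$ and $\bigsqcup_n b_n=b$. A predomain base is a countable poset with decidable order in which every element has an approximating sequence. A nonempty finite subset is consistent if it weakly has an upper bound; bounded complete means every finite consistent subset has a least upper bound. The continuous completion $\hat B$ is the set of increasing sequences in $B$, preordered by $(b_n)\sqsubseteq(b'_n)$ iff for all $b\in B$, $n$, $b\ll b_n$ implies $\tilde\exists m.\,b\ll b'_m$; equality is mutual $\sqsubseteq$; $\ll$ on $\hat B$ is the way-below relation of this poset. -}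

module Defs where

open import Level using (Level; _⊔_)
open import Data.Nat using (ℕ)
open import Data.Maybe using (Maybe; just)
open import Data.Product using (Σ; ∃; _×_; _,_; proj₁)
open import Data.List using (List; _∷_)
open import Data.List.Relation.Unary.All using (All)
open import Data.List.Relation.Unary.Any using (Any)
open import Relation.Nullary using (¬_)
open import Relation.Binary.Core using (Rel)
open import Relation.Binary.Definitions using (Decidable)
open import Relation.Binary.Bundles using (Poset)
open import Relation.Binary.PropositionalEquality using (_≡_)

module Order {a ℓ : Level} {A : Set a} (_≤_ : Rel A ℓ) where

  ∃̃ : ∀ {p} → (ℕ → Set p) → Set p
  ∃̃ P = ¬ (∀ n → ¬ P n)

  IsChain : (ℕ → A) → Set ℓ
  IsChain x = ∀ n → x n ≤ x (Data.Nat.suc n)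

  IsSup : (ℕ → A) → A → Set (a ⊔ ℓ)
  IsSup x s = (∀ n → x n ≤ s) × (∀ u → (∀ n → x n ≤ u) → s ≤ u)

  _≪_ : A → A → Set (a ⊔ ℓ)
  b ≪ c = (x : ℕ → A) → IsChain x → (s : A) → IsSup x s → c ≤ s →
          ∃̃ (λ n → b ≤ x n)

  record ApproxSeq (b : A) : Set (a ⊔ ℓ) where
    field
      seq      : ℕ → A
      chain    : IsChain seq
      waybelow : ∀ n → seq n ≪ b
      sup      : IsSup seq b

record PredomainBase (c ℓ₁ ℓ₂ : Level) : Set (Level.suc (c ⊔ ℓ₁ ⊔ ℓ₂)) where
  field
    poset : Poset c ℓ₁ ℓ₂
  open Poset poset public renaming (_≤_ to _⊑_)
  open Order _⊑_ public
  field
    _⊑?_      : Decidable _⊑_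
    -- countable: an enumeration (allowing gaps, so B may be empty)
    enum      : ℕ → Maybe Carrier
    enum-surj : ∀ b → ∃ λ n → enum n ≡ just b
    approx    : ∀ b → ApproxSeq b

module _ {c ℓ₁ ℓ₂} (B : PredomainBase c ℓ₁ ℓ₂) where
  open PredomainBase B

  -- finite nonempty subsets are given as nonempty lists
  IsUpperBound : List Carrier → Carrier → Set (c ⊔ ℓ₂)
  IsUpperBound xs u = All (_⊑ u) xs

  Consistent : List Carrier → Set (c ⊔ ℓ₂)
  Consistent xs = ¬ ¬ (∃ λ u → IsUpperBound xs u)

  IsLUB : List Carrier → Carrier → Set (c ⊔ ℓ₂)
  IsLUB xs s = IsUpperBound xs s × (∀ u → IsUpperBound xs u → s ⊑ u)

  BoundedComplete : Set (c ⊔ ℓ₂)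
  BoundedComplete = ∀ (x : Carrier) (xs : List Carrier) →
    Consistent (x ∷ xs) → ∃ λ s → IsLUB (x ∷ xs) s

  B̂ : Set (c ⊔ ℓ₂)
  B̂ = Σ (ℕ → Carrier) IsChain

  _⊑̂_ : B̂ → B̂ → Set (c ⊔ ℓ₂)
  (x , _) ⊑̂ (y , _) = ∀ (b : Carrier) (n : ℕ) → b ≪ x n → ∃̃ (λ m → b ≪ y m)

  -- way-below relation of the poset B̂ (equality = mutual ⊑̂)
  _≪̂_ : B̂ → B̂ → Set (c ⊔ ℓ₂)
  _≪̂_ = Order._≪_ _⊑̂_

  ι : Carrier → B̂
  ι b = (λ _ → b) , (λ _ → refl)

module Submission where

-- Order: ι b ⊑̂ ι b' unfolds to "every d ≪ b weakly satisfies d ≪ b'".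
-- This follows from b ⊑ b'; conversely it puts every approximant of b below
-- b' (≪ implies ⊑, using decidability of ⊑ to drop a double negation), and
-- b is the supremum of its approximants.
--
-- Way-below: the heart of the proof is a diagonal construction.  Given a
-- chain X in B̂, enumerate all approximants of all elements X k j and join
-- them up cumulatively (bounded completeness) into a single chain U in B,
-- each U t lying way below some stage of X t.  Applied to the constant
-- chains of an approximating sequence of x, U is an approximating chain of x,
-- which shows that every d ≪ x lies way below some approximant of x.  With
-- that, U bounds an arbitrary chain X in B̂, so its supremum S satisfies
-- S ⊑̂ U; if ι b' ⊑̂ S and b ≪ b', then b lies below some U t, hence below a
-- stage of X t, i.e. ι b ⊑̂ X t.

open import Defs
open import Level using () renaming (_⊔_ to _⊔ₗ_)
open import Data.Product using (_×_; _,_; proj₁; proj₂; Σ; ∃)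
open import Function.Bundles using (_⇔_; mk⇔)
open import Data.Nat using (ℕ; zero; suc; _≤_; _≤′_; ≤′-refl; ≤′-step; _+_; z≤n; s≤s; _⊔_)
open import Data.Nat.Properties using (≤⇒≤′; +-suc; +-identityʳ; m≤m⊔n; m≤n⊔m)
open import Data.List using ([]; _∷_)
open import Data.List.Relation.Unary.All using ([]; _∷_)
open import Relation.Nullary using (¬_)
open import Relation.Nullary.Decidable using (decidable-stable)
import Relation.Binary.PropositionalEquality as ≡
open ≡ using (_≡_; cong; subst)

≤-propagate : ∀ {p} (P : ℕ → Set p) → (∀ n → P n → P (suc n)) →
  ∀ {m n} → m ≤ n → P m → P n
≤-propagate P step {m} m≤n = go (≤⇒≤′ m≤n)
  where
  go : ∀ {n} → m ≤′ n → P m → P n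
  go ≤′-refl       pm = pm
  go (≤′-step m≤n) pm = step _ (go m≤n pm)

-- Cantor's enumeration of ℕ × ℕ: walk down each anti-diagonal i + p = q,
-- then jump to the start (0 , q + 1) of the next one.
next : ℕ × ℕ → ℕ × ℕ
next (i , zero)  = (zero , suc i)
next (i , suc p) = (suc i , p)

unpair : ℕ → ℕ × ℕ
unpair zero    = (0 , 0)
unpair (suc t) = next (unpair t)

unpair-fst≤ : ∀ t → proj₁ (unpair t) ≤ t
unpair-fst≤ zero = z≤n
unpair-fst≤ (suc t) with unpair t | unpair-fst≤ t
... | (i , zero)  | _    = z≤n
... | (i , suc p) | i≤t  = s≤s i≤t

unpair-walk : ∀ i p t → unpair t ≡ (0 , i + p) → unpair (i + t) ≡ (i , p)
unpair-walk zero    p t e = e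
unpair-walk (suc i) p t e =
  cong next (unpair-walk i (suc p) t (≡.trans e (cong (0 ,_) (≡.sym (+-suc i p)))))

unpair-start : ∀ q → ∃ λ t → unpair t ≡ (0 , q)
unpair-start zero = 0 , ≡.refl
unpair-start (suc q) with unpair-start q
... | t , e = suc (q + t) ,
  cong next (unpair-walk q 0 t (≡.trans e (cong (0 ,_) (≡.sym (+-identityʳ q)))))

unpair-surjective : ∀ i p → ∃ λ t → unpair t ≡ (i , p)
unpair-surjective i p with unpair-start (i + p)
... | t , e = i + t , unpair-walk i p t e

-- Enumeration of ℕ × ℕ × ℕ whose first coordinate stays below the counter.
untriple : ℕ → ℕ × ℕ × ℕ
untriple t = proj₁ (unpair t) , unpair (proj₂ (unpair t))

untriple-surjective : ∀ k j n → ∃ λ t → untriple t ≡ (k , j , n)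
untriple-surjective k j n with unpair-surjective j n
... | p , ep with unpair-surjective k p
...   | t , et = t , ≡.trans (cong (λ z → proj₁ z , unpair (proj₂ z)) et) (cong (k ,_) ep)

module BaseFacts {c ℓ₁ ℓ₂} (B : PredomainBase c ℓ₁ ℓ₂) where
  open PredomainBase B

  ⊑-stable : ∀ {x y} → ¬ ¬ (x ⊑ y) → x ⊑ y
  ⊑-stable = decidable-stable (_ ⊑? _)

  chain-mono : ∀ {f} → IsChain f → ∀ {m n} → m ≤ n → f m ⊑ f n
  chain-mono {f} f-chain {m} m≤n =
    ≤-propagate (λ n → f m ⊑ f n) (λ n fm⊑fn → trans fm⊑fn (f-chain n)) m≤n refl

  const-sup : ∀ y → IsSup (λ _ → y) y
  const-sup y = (λ _ → refl) , (λ u y⊑u → y⊑u 0)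

  -- Test x ≪ y against the constant chain at y.
  ≪⇒⊑ : ∀ {x y} → x ≪ y → x ⊑ y
  ≪⇒⊑ {y = y} x≪y = ⊑-stable λ x⋢y →
    x≪y (λ _ → y) (λ _ → refl) y (const-sup y) refl (λ _ → x⋢y)

  ⊑-≪-trans : ∀ {x y z} → x ⊑ y → y ≪ z → x ≪ z
  ⊑-≪-trans x⊑y y≪z f f-chain s s-sup z⊑s none =
    y≪z f f-chain s s-sup z⊑s (λ n y⊑fn → none n (trans x⊑y y⊑fn))

  ≪-⊑-trans : ∀ {x y z} → x ≪ y → y ⊑ z → x ≪ z
  ≪-⊑-trans x≪y y⊑z f f-chain s s-sup z⊑s = x≪y f f-chain s s-sup (trans y⊑z z⊑s)

  -- The join of two elements way below z is way below z: both are caught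
  -- by the chain at stages n and m, so their join is caught at n ⊔ m.
  ≪-join : ∀ {x y s z} → x ≪ z → y ≪ z → IsLUB B (x ∷ y ∷ []) s → s ≪ z
  ≪-join x≪z y≪z (_ , least) f f-chain t t-sup z⊑t none =
    x≪z f f-chain t t-sup z⊑t λ n x⊑fn →
    y≪z f f-chain t t-sup z⊑t λ m y⊑fm →
    none (n ⊔ m) (least (f (n ⊔ m))
      (trans x⊑fn (chain-mono f-chain (m≤m⊔n n m)) ∷
       trans y⊑fm (chain-mono f-chain (m≤n⊔m n m)) ∷ []))

  lub-left : ∀ {x y s} → IsLUB B (x ∷ y ∷ []) s → x ⊑ s
  lub-left ((x⊑s ∷ _) , _) = x⊑s

  lub-right : ∀ {x y s} → IsLUB B (x ∷ y ∷ []) s → y ⊑ s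
  lub-right ((_ ∷ y⊑s ∷ []) , _) = y⊑s

  ι-⊑̂ : ∀ {b} (x : B̂ B) J → b ⊑ proj₁ x J → _⊑̂_ B (ι B b) x
  ι-⊑̂ x J b⊑xJ d _ d≪b none = none J (≪-⊑-trans d≪b b⊑xJ)

  -- ι reflects ⊑: every approximant of b lies below b', so b does.
  ι-reflects-⊑ : ∀ {b b'} → _⊑̂_ B (ι B b) (ι B b') → b ⊑ b'
  ι-reflects-⊑ {b} {b'} ιb⊑ιb' = proj₂ sup b' λ n → ⊑-stable λ bₙ⋢b' →
    ιb⊑ιb' (seq n) 0 (waybelow n) (λ _ bₙ≪b' → bₙ⋢b' (≪⇒⊑ bₙ≪b'))
    where open ApproxSeq (approx b)

  Below : B̂ B → Carrier → Set (c ⊔ₗ ℓ₂)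
  Below x e = ∃̃ λ J → e ≪ proj₁ x J

  Below-⊑̂ : ∀ {e} x y → _⊑̂_ B x y → Below x e → Below y e
  Below-⊑̂ {e} _ _ x⊑̂y below none = below λ J e≪xJ → x⊑̂y e J e≪xJ none

  Below-consistent : ∀ {d e} x → Below x d → Below x e → Consistent B (d ∷ e ∷ [])
  Below-consistent x d-below e-below no-bound =
    d-below λ J d≪xJ → e-below λ J' e≪xJ' →
    no-bound (proj₁ x (J ⊔ J') ,
      trans (≪⇒⊑ d≪xJ) (chain-mono (proj₂ x) (m≤m⊔n J J')) ∷
      trans (≪⇒⊑ e≪xJ') (chain-mono (proj₂ x) (m≤n⊔m J J')) ∷ [])

  Below-join : ∀ {d e s} x → Below x d → Below x e → IsLUB B (d ∷ e ∷ []) s → Below x s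
  Below-join x d-below e-below lub none =
    d-below λ J d≪xJ → e-below λ J' e≪xJ' →
    none (J ⊔ J') (≪-join (≪-⊑-trans d≪xJ (chain-mono (proj₂ x) (m≤m⊔n J J')))
                          (≪-⊑-trans e≪xJ' (chain-mono (proj₂ x) (m≤n⊔m J J'))) lub)

-- The diagonal chain of a chain X in B̂: U 0 is the first enumerated
-- approximant and U (t+1) joins U t with the next one.  Every U t stays way
-- below some stage of X t (the join is taken among such elements, which are
-- consistent), and every approximant of every X k j is below some U t.
module Diagonal {c ℓ₁ ℓ₂} (B : PredomainBase c ℓ₁ ℓ₂) (bc : BoundedComplete B)
  (X : ℕ → B̂ B) (X-chain : ∀ t → _⊑̂_ B (X t) (X (suc t))) where
  open PredomainBase B
  open BaseFacts B

  approximant : ℕ × ℕ × ℕ → Carrier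
  approximant (k , j , n) = ApproxSeq.seq (approx (proj₁ (X k) j)) n

  Below-mono : ∀ {k t e} → k ≤ t → Below (X k) e → Below (X t) e
  Below-mono {e = e} =
    ≤-propagate (λ t → Below (X t) e) (λ t → Below-⊑̂ (X t) (X (suc t)) (X-chain t))

  -- The t-th enumerated approximant; it comes from some X k j with k ≤ t,
  -- so it is way below a stage of X t.
  g : ℕ → Carrier
  g t = approximant (untriple t)

  g-below : ∀ t → Below (X t) (g t)
  g-below t = Below-mono (unpair-fst≤ t) (λ none → none j (waybelow n))
    where
    j = proj₁ (unpair (proj₂ (unpair t)))
    n = proj₂ (unpair (proj₂ (unpair t)))
    open ApproxSeq (approx (proj₁ (X (proj₁ (unpair t))) j))

  -- U and its invariant are defined together: the invariant at t (carried
  -- over to X (t+1)) makes U t and g (t+1) consistent, so their join exists.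
  U : ℕ → Carrier
  U-below : ∀ t → Below (X t) (U t)
  U-below-next : ∀ t → Below (X (suc t)) (U t)
  next-lub : ∀ t → Σ Carrier (IsLUB B (U t ∷ g (suc t) ∷ []))

  U zero    = g 0
  U (suc t) = proj₁ (next-lub t)

  U-below zero    = g-below 0
  U-below (suc t) =
    Below-join (X (suc t)) (U-below-next t) (g-below (suc t)) (proj₂ (next-lub t))

  next-lub t = bc (U t) (g (suc t) ∷ [])
    (Below-consistent (X (suc t)) (U-below-next t) (g-below (suc t)))

  U-below-next t = Below-⊑̂ (X t) (X (suc t)) (X-chain t) (U-below t)

  U-chain : IsChain U
  U-chain t = lub-left (proj₂ (next-lub t))

  g⊑U : ∀ t → g t ⊑ U t
  g⊑U zero    = refl
  g⊑U (suc t) = lub-right (proj₂ (next-lub t))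

  Û : B̂ B
  Û = U , U-chain

  approximant⊑U : ∀ k j n → ∃ λ t → approximant (k , j , n) ⊑ U t
  approximant⊑U k j n with untriple-surjective k j n
  ... | t , e = t , subst (λ z → approximant z ⊑ U t) e (g⊑U t)

module Main {c ℓ₁ ℓ₂} (B : PredomainBase c ℓ₁ ℓ₂) (bc : BoundedComplete B) where
  open PredomainBase B
  open BaseFacts B

  -- Anything way below x is way below some member of its approximating
  -- sequence: the diagonal chain of the constant chains at those members
  -- has supremum x, and each of its elements is way below such a member.
  ≪-approximant : ∀ {d x} → d ≪ x → ∃̃ λ n → d ≪ ApproxSeq.seq (approx x) n
  ≪-approximant {x = x} d≪x none =
    d≪x U U-chain x U-sup refl λ t d⊑Ut →
    U-below t λ _ Ut≪xₜ → none t (⊑-≪-trans d⊑Ut Ut≪xₜ)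
    where
    open ApproxSeq (approx x)
    open Diagonal B bc (λ t → ι B (seq t)) (λ t → ι-⊑̂ (ι B (seq (suc t))) 0 (chain t))
    U-sup : IsSup U x
    U-sup = U⊑x , x⊑ub
      where
      U⊑x : ∀ t → U t ⊑ x
      U⊑x t = ⊑-stable λ Ut⋢x → U-below t λ _ Ut≪xₜ →
        Ut⋢x (trans (≪⇒⊑ Ut≪xₜ) (proj₁ sup t))
      x⊑ub : ∀ u → (∀ t → U t ⊑ u) → x ⊑ u
      x⊑ub u U⊑u = proj₂ sup u λ k → proj₂ (ApproxSeq.sup (approx (seq k))) u λ n →
        let (t , a⊑Ut) = approximant⊑U k 0 n in trans a⊑Ut (U⊑u t)

  -- ι preserves ≪: the diagonal chain of X bounds X in B̂, hence its supremum.
  ι-preserves-≪ : ∀ {b b'} → b ≪ b' → _≪̂_ B (ι B b) (ι B b')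
  ι-preserves-≪ {b} b≪b' X X-chain S (_ , S-least) ιb'⊑̂S none =
    ιb'⊑̂S b 0 b≪b' λ m b≪Sₘ →
    S⊑̂U b m b≪Sₘ λ t b≪Ut →
    U-below t λ J Ut≪XtJ →
    none t (ι-⊑̂ (X t) J (trans (≪⇒⊑ b≪Ut) (≪⇒⊑ Ut≪XtJ)))
    where
    open Diagonal B bc X X-chain
    X⊑̂U : ∀ k → _⊑̂_ B (X k) Û
    X⊑̂U k d j d≪Xkj none' = ≪-approximant d≪Xkj λ n d≪a →
      let (t , a⊑Ut) = approximant⊑U k j n in none' t (≪-⊑-trans d≪a a⊑Ut)
    S⊑̂U : _⊑̂_ B S Û
    S⊑̂U = S-least Û X⊑̂U

lemma3p8 : ∀ {c ℓ₁ ℓ₂} (B : PredomainBase c ℓ₁ ℓ₂) → BoundedComplete B →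
    (∀ b b' → PredomainBase._⊑_ B b b' ⇔ _⊑̂_ B (ι B b) (ι B b'))
    × (∀ b b' → PredomainBase._≪_ B b b' → _≪̂_ B (ι B b) (ι B b'))
-- ι preserves ⊑ because b ⊑ b' is b below the (constant) stage 0 of ι b'.
lemma3p8 B bc =
  (λ b b' → mk⇔ (ι-⊑̂ (ι B b') 0) ι-reflects-⊑) ,
  (λ b b' → ι-preserves-≪)
  where
  open BaseFacts B
  open Main B bc
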